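{- Let $r,n\ge1$ be integers and $c,d\in\mathbb{Z}$, and put $\mathscr{d}_1=\gcd(c-d,n)$, $\mathscr{d}_2=\gcd(c+(r-1)d,n)$. Let $S_{coroot}(c,d,r,n)$ be the number of $\boldsymbol{x}=(x_1,\dots,x_r)\in(\mathbb{Z}/n\mathbb{Z})^r$ satisfying the system \[(c-d)(x_i-x_r)\equiv 0\pmod n\ \text{ for all } i\in\{1,\dots,r-1\},\qquad (c+(r-1)d)(x_1+\cdots+x_r)\equiv 0\pmod n.\] Then \[S_{coroot}(c,d,r,n)=\mathscr{d}_1^{\,r-1}\,\mathscr{d}_2\,\gcd\left(\frac{n}{\mathscr{d}_1},\frac{n}{\mathscr{d}_2},r\right).\] -}

module Defs where

open import Data.Nat as ℕ using (ℕ; suc; zero; NonZero; _/_)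
open import Data.Nat.GCD as G using ()
open import Data.Nat.Divisibility as ND using ()
open import Data.Integer as ℤ using (ℤ; +_; _-_; _*_; ∣_∣)
open import Data.Integer.Divisibility using (_∣_)
open import Data.Fin using (Fin; toℕ; fromℕ)
open import Data.List using (List; []; _∷_; length; filter; allFin; map; concatMap; foldr)
open import Data.Vec.Functional using (Vector)
open import Data.Product using (_×_)
open import Relation.Nullary using (Dec)
open import Relation.Nullary.Decidable using (_×-dec_)
open import Data.Sum using (inj₂)

-- All functions Fin r → Fin n (i.e. all elements of (ℤ/nℤ)^r, residues
-- represented by 0..n-1), listed exhaustively without repetition.
allVecs : (r n : ℕ) → List (Vector (Fin n) r)
allVecs zero    n = (λ ()) ∷ []
allVecs (suc r) n =
  concatMap (λ a → map (λ v → λ { Fin.zero → a ; (Fin.suc i) → v i }) (allVecs r n)) (allFin n)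

ι : ∀ {n} → Fin n → ℤ
ι x = + toℕ x

sumℤ : ∀ {r n} → Vector (Fin n) r → ℤ
sumℤ {zero}  x = + 0
sumℤ {suc r} x = ι (x Fin.zero) ℤ.+ sumℤ (λ i → x (Fin.suc i))

_≡0mod_ : ℤ → ℕ → Set
a ≡0mod n = (+ n) ∣ a

_≡0mod?_ : (a : ℤ) (n : ℕ) → Dec (a ≡0mod n)
a ≡0mod? n = n ND.∣? ∣ a ∣

-- the system, with the index r written as suc r' so that x_r = x (fromℕ r')
-- and i ranges over the first r' = r-1 indices
-- decidability for ∀ i : Fin k
allFin? : ∀ k {P : Fin k → Set} → ((i : Fin k) → Dec (P i)) → Dec ((i : Fin k) → P i)
allFin? k P? = Data.Fin.Properties.all? P?
  where import Data.Fin.Properties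

open import Data.Fin using (inject₁)

IsSolution : (c d : ℤ) (r' n : ℕ) → Vector (Fin n) (suc r') → Set
IsSolution c d r' n x =
  ((i : Fin r') → ((c - d) * (ι (x (inject₁ i)) - ι (x (fromℕ r')))) ≡0mod n)
  × (((c ℤ.+ (+ r') * d) * sumℤ x) ≡0mod n)

isSolution? : (c d : ℤ) (r' n : ℕ) (x : Vector (Fin n) (suc r')) → Dec (IsSolution c d r' n x)
isSolution? c d r' n x =
  allFin? r' (λ i → ((c - d) * (ι (x (inject₁ i)) - ι (x (fromℕ r')))) ≡0mod? n)
  ×-dec (((c ℤ.+ (+ r') * d) * sumℤ x) ≡0mod? n)

Scoroot : (c d : ℤ) (r' n : ℕ) → ℕ
Scoroot c d r' n = length (filter (isSolution? c d r' n) (allVecs (suc r') n))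

gcdℤ : ℤ → ℕ → ℕ
gcdℤ a n = G.gcd ∣ a ∣ n

gcdℤ-nonZero : ∀ a n → .{{NonZero n}} → NonZero (gcdℤ a n)
gcdℤ-nonZero a n = ℕ.≢-nonZero (G.gcd[m,n]≢0 ∣ a ∣ n (inj₂ (ℕ.≢-nonZero⁻¹ n)))

n/gcdℤ : (a : ℤ) (n : ℕ) → .{{NonZero n}} → ℕ
n/gcdℤ a n = _/_ n (gcdℤ a n) {{gcdℤ-nonZero a n}}

module Submission where

-- Since gcd(a, n) · (n / gcd(a, n)) = n and a / gcd(a, n) is coprime to n / gcd(a, n), the congruence
-- a·y ≡ 0 (mod n) says exactly y ≡ 0 (mod n / gcd(a, n)).  With m₁ = n/𝒹₁ and m₂ = n/𝒹₂ the system
-- therefore says: all xᵢ are congruent to x₁ modulo m₁, and x₁ + ⋯ + x_r ≡ 0 (mod m₂).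
--
-- Fix x₁ = a and fill in the remaining coordinates from the left.  Each coordinate but the last ranges
-- over the 𝒹₁ residues ≡ a (mod m₁); the last one, t, must satisfy t ≡ a (mod m₁) and t ≡ −(previous
-- sum) (mod m₂).  By the Chinese remainder theorem this has n / lcm(m₁, m₂) solutions when
-- g = gcd(m₁, m₂) divides a + (previous sum), and none otherwise; modulo g that quantity is r·a, whatever
-- the earlier coordinates were.  Finally g ∣ r·a holds for (n/g)·gcd(r, g) values of a, and
-- g · lcm(m₁, m₂) = m₁ m₂ turns (n/g) · (n / lcm(m₁, m₂)) into 𝒹₁ 𝒹₂.

open import Defs
open import Data.Nat using (ℕ; NonZero)
import Data.Nat as ℕ
open import Relation.Binary.PropositionalEquality using (_≡_; trans)

module Counting where

  open import Data.Nat using (suc; _+_; _*_)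
  open import Data.Nat.ListAction using (sum)
  open import Data.List using (List; []; _∷_; [_]; _++_; length; filter; map; concatMap)
  open import Data.List.Properties using (length-++; filter-++; filter-≐; filter-none)
  open import Data.List.Relation.Unary.All using (All)
  open import Data.Product using (_,_)
  open import Function using (_∘_; _⇔_; mk⇔; Equivalence)
  open import Level using (Level)
  open import Relation.Nullary using (¬_; yes; no)
  open import Relation.Unary using (Pred; Decidable; ∁)
  open import Relation.Binary.PropositionalEquality using (refl; sym; trans; cong; cong₂; subst; _≗_)

  private variable
    a b p q : Level
    A B : Set a

  count : {P : Pred A p} → Decidable P → List A → ℕ
  count P? = length ∘ filter P?

  count-⇔ : {P : Pred A p} {Q : Pred A q} (P? : Decidable P) (Q? : Decidable Q) →
            (∀ x → P x ⇔ Q x) → ∀ xs → count P? xs ≡ count Q? xs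
  count-⇔ P? Q? P⇔Q xs =
    cong length (filter-≐ P? Q? ((λ {x} → Equivalence.to (P⇔Q x)) , (λ {x} → Equivalence.from (P⇔Q x))) xs)

  module _ {P : Pred A p} (P? : Decidable P) where

    count-++ : ∀ xs ys → count P? (xs ++ ys) ≡ count P? xs + count P? ys
    count-++ xs ys = trans (cong length (filter-++ P? xs ys)) (length-++ (filter P? xs))

    count-none : ∀ {xs} → All (∁ P) xs → count P? xs ≡ 0
    count-none ¬Ps = cong length (filter-none P? ¬Ps)

    count-map : (f : B → A) → ∀ xs → count P? (map f xs) ≡ count (P? ∘ f) xs
    count-map f []       = refl
    count-map f (x ∷ xs) with P? (f x)
    ... | yes _ = cong suc (count-map f xs)
    ... | no  _ = count-map f xs

    count-∘-cong : {f g : B → A} → f ≗ g → ∀ xs → count (P? ∘ f) xs ≡ count (P? ∘ g) xs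
    count-∘-cong f≗g = count-⇔ _ _ λ x → mk⇔ (subst P (f≗g x)) (subst P (sym (f≗g x)))

    count-concatMap : (f : B → List A) → ∀ xs → count P? (concatMap f xs) ≡ sum (map (count P? ∘ f) xs)
    count-concatMap f []       = refl
    count-concatMap f (x ∷ xs) =
      trans (count-++ (f x) (concatMap f xs)) (cong (count P? (f x) +_) (count-concatMap f xs))

    sum-indicator : ∀ (f : A → ℕ) c → (∀ x → P x → f x ≡ c) → (∀ x → ¬ P x → f x ≡ 0) →
                    ∀ xs → sum (map f xs) ≡ count P? xs * c
    sum-indicator f c on off []       = refl
    sum-indicator f c on off (x ∷ xs) with P? x
    ... | yes px  = cong₂ _+_ (on x px)   (sum-indicator f c on off xs)
    ... | no  ¬px = cong₂ _+_ (off x ¬px) (sum-indicator f c on off xs)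

  sum-count-singleton : {Q : B → Pred A p} (Q? : ∀ x → Decidable (Q x)) (e : A) →
                        ∀ xs → sum (map (λ x → count (Q? x) [ e ]) xs) ≡ count (λ x → Q? x e) xs
  sum-count-singleton Q? e []       = refl
  sum-count-singleton Q? e (x ∷ xs) with Q? x e
  ... | yes _ = cong suc (sum-count-singleton Q? e xs)
  ... | no  _ = sum-count-singleton Q? e xs

module Divisibility where

  open import Data.Nat using (_*_; _/_)
  open import Data.Nat.Properties using (*-comm)
  open import Data.Nat.Divisibility as ℕ using (*-cancelˡ-∣; *-pres-∣)
  open import Data.Nat.DivMod using (m/n*n≡m)
  open import Data.Nat.GCD using (gcd; gcd-GCD; gcd[m,n]∣m; gcd[m,n]∣n; module Bézout)
  open import Data.Nat.LCM using (lcm; m∣lcm[m,n]; n∣lcm[m,n]; lcm-least)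
  open import Data.Nat.Coprimality as Coprime using (coprime-/gcd; coprime-divisor)
  import Data.Nat.Tactic.RingSolver as ℕ-Solver
  open import Data.Integer as ℤ using (ℤ; +_; -_; _+_)
  open import Data.Integer.Properties using (abs-*; pos-+; pos-*)
  open import Data.Integer.Divisibility.Signed using (_∣_; ∣ᵤ⇒∣; ∣⇒∣ᵤ; ∣-trans; ∣m∣n⇒∣m+n; ∣m+n∣n⇒∣m)
  open import Data.Integer.Tactic.RingSolver using (solve-∀)
  open import Data.Product using (∃₂; _×_; _,_)
  open import Function using (_∘_; _⇔_; mk⇔; Equivalence)
  open Equivalence using (to; from)
  open import Relation.Binary.PropositionalEquality using (refl; sym; trans; cong; subst; subst₂; module ≡-Reasoning)

  ∣-shift : ∀ {k a b c} → k ∣ b → a + b ≡ c → k ∣ c ⇔ k ∣ a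
  ∣-shift k∣b refl = mk⇔ (λ k∣a+b → ∣m+n∣n⇒∣m k∣a+b k∣b) (λ k∣a → ∣m∣n⇒∣m+n k∣a k∣b)

  ∣-+-cong : ∀ {k} z {u u′} → k ∣ u ℤ.- u′ → k ∣ z + u ⇔ k ∣ z + u′
  ∣-+-cong z {u} {u′} k∣u-u′ = ∣-shift k∣u-u′ (exchange z u u′)
    where exchange : ∀ z u u′ → (z + u′) + (u ℤ.- u′) ≡ z + u
          exchange = solve-∀

  lcm∣⇔ : ∀ m₁ m₂ x → + lcm m₁ m₂ ∣ x ⇔ (+ m₁ ∣ x × + m₂ ∣ x)
  lcm∣⇔ m₁ m₂ x = mk⇔
    (λ L∣x → ∣-trans (∣ᵤ⇒∣ (m∣lcm[m,n] m₁ m₂)) L∣x , ∣-trans (∣ᵤ⇒∣ (n∣lcm[m,n] m₁ m₂)) L∣x)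
    (λ (m₁∣x , m₂∣x) → ∣ᵤ⇒∣ (lcm-least (∣⇒∣ᵤ m₁∣x) (∣⇒∣ᵤ m₂∣x)))

  bézout : ∀ m₁ m₂ → ∃₂ λ X Y → + gcd m₁ m₂ ≡ X ℤ.* + m₁ + Y ℤ.* + m₂
  bézout m₁ m₂ = toℤ (Bézout.identity (gcd-GCD m₁ m₂))
    where
    lift : ∀ a b c d e → a ℕ.+ b * c ≡ d * e → + a + + b ℤ.* + c ≡ + d ℤ.* + e
    lift a b c d e eq = begin
      + a + + b ℤ.* + c  ≡⟨ cong (_+_ (+ a)) (pos-* b c) ⟨
      + a + + (b * c)    ≡⟨ pos-+ a (b * c) ⟨
      + (a ℕ.+ b * c)    ≡⟨ cong +_ eq ⟩
      + (d * e)          ≡⟨ pos-* d e ⟩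
      + d ℤ.* + e        ∎
      where open ≡-Reasoning
    isolateʳ : ∀ a y k c → a + y ℤ.* k ≡ c → a ≡ c + - y ℤ.* k
    isolateʳ a y k c eq = trans (identity a y k) (cong (_+ - y ℤ.* k) eq)
      where identity : ∀ a y k → a ≡ (a + y ℤ.* k) + - y ℤ.* k
            identity = solve-∀
    isolateˡ : ∀ a x k c → a + x ℤ.* k ≡ c → a ≡ - x ℤ.* k + c
    isolateˡ a x k c eq = trans (identity a x k) (cong (_+_ (- x ℤ.* k)) eq)
      where identity : ∀ a x k → a ≡ - x ℤ.* k + (a + x ℤ.* k)
            identity = solve-∀
    toℤ : ∀ {d} → Bézout.Identity d m₁ m₂ → ∃₂ λ X Y → + d ≡ X ℤ.* + m₁ + Y ℤ.* + m₂
    toℤ {d} (Bézout.+- x y eq) = + x , - + y , isolateʳ (+ d) (+ y) (+ m₂) _ (lift d y m₂ x m₁ eq)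
    toℤ {d} (Bézout.-+ x y eq) = - + x , + y , isolateˡ (+ d) (+ x) (+ m₁) _ (lift d x m₁ y m₂ eq)

  ∣*⇔/gcd∣ : ∀ k a t .{{_ : NonZero (gcd a k)}} → k ℕ.∣ a * t ⇔ k / gcd a k ℕ.∣ t
  ∣*⇔/gcd∣ k a t = mk⇔
    (λ k∣at → coprime-divisor (Coprime.sym (coprime-/gcd a k))
                (*-cancelˡ-∣ g (subst₂ ℕ._∣_ (trans (sym k′g≡k) (*-comm k′ g)) at≡g[a′t] k∣at)))
    (λ k′∣t → subst₂ ℕ._∣_ k′g≡k (*-comm t a) (*-pres-∣ k′∣t (gcd[m,n]∣m a k)))
    where
    g  = gcd a k
    k′ = k / g
    k′g≡k : k′ * g ≡ k
    k′g≡k = m/n*n≡m (gcd[m,n]∣n a k)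
    at≡g[a′t] : a * t ≡ g * (a / g * t)
    at≡g[a′t] = trans (cong (_* t) (sym (m/n*n≡m (gcd[m,n]∣m a k)))) (rearrange (a / g) g t)
      where rearrange : ∀ a′ g t → a′ * g * t ≡ g * (a′ * t)
            rearrange = ℕ-Solver.solve-∀

  ∣*⇔/gcd∣ℤ : ∀ k a t .{{_ : NonZero (gcd ℤ.∣ a ∣ k)}} → + k ∣ a ℤ.* t ⇔ + (k / gcd ℤ.∣ a ∣ k) ∣ t
  ∣*⇔/gcd∣ℤ k a t = mk⇔
    (λ k∣at → ∣ᵤ⇒∣ (to onℕ (subst (k ℕ.∣_) (abs-* a t) (∣⇒∣ᵤ k∣at))))
    (λ k′∣t → ∣ᵤ⇒∣ (subst (k ℕ.∣_) (sym (abs-* a t)) (from onℕ (∣⇒∣ᵤ k′∣t))))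
    where onℕ = ∣*⇔/gcd∣ k ℤ.∣ a ∣ ℤ.∣ t ∣

  ≡0mod⇔ : ∀ n .{{_ : NonZero n}} a t → (a ℤ.* t) ≡0mod n ⇔ + n/gcdℤ a n ∣ t
  ≡0mod⇔ n a t = mk⇔ (to equivalence ∘ ∣ᵤ⇒∣) (∣⇒∣ᵤ ∘ from equivalence)
    where
    instance _ = gcdℤ-nonZero a n
    equivalence = ∣*⇔/gcd∣ℤ n a t

module Residues where

  open Counting
  open Divisibility using (∣-shift)
  open import Data.Nat using (zero; suc; _+_; _*_; _<_; s<s)
  open import Data.Nat.Properties using (+-assoc; +-comm; +-identityʳ; +-cancelʳ-≡; *-zeroʳ; *-suc; <⇒≱)
  open import Data.Nat.Divisibility using (∣⇒≤)
  open import Data.Integer using (ℤ; +_; -[1+_]; 0ℤ; 1ℤ) renaming (_+_ to _+ℤ_)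
  open import Data.Integer.Properties using (pos-+)
  open import Data.Integer.Divisibility.Signed using (_∣_; _∣?_; divides; ∣⇒∣ᵤ; ∣-refl)
  open import Data.Integer.Tactic.RingSolver using (solve-∀)
  open import Data.Fin using (toℕ)
  open import Data.List using ([]; _∷_; [_]; length; map; upTo; applyUpTo; allFin; tabulate)
  open import Data.List.Properties using (filter-accept; map-upTo; map-tabulate)
  open import Data.List.Relation.Unary.All.Properties using (applyUpTo⁺₁)
  open import Function using (_∘_)
  open import Level using (Level)
  open import Relation.Nullary using (¬_; contradiction)
  open import Relation.Unary using (Pred; Decidable)
  open import Relation.Binary.PropositionalEquality using (refl; sym; trans; cong; cong₂; subst; module ≡-Reasoning)

  private variable
    a p : Level
    A : Set a

  map-toℕ-allFin : ∀ n → map toℕ (allFin n) ≡ upTo n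
  map-toℕ-allFin n = trans (map-tabulate (λ i → i) toℕ) (tabulate-toℕ n)
    where
    open ≡-Reasoning
    tabulate-toℕ : ∀ n → tabulate (toℕ {n}) ≡ upTo n
    tabulate-toℕ zero    = refl
    tabulate-toℕ (suc n) = cong (0 ∷_) (begin
      tabulate (suc ∘ toℕ)    ≡⟨ map-tabulate toℕ suc ⟨
      map suc (tabulate toℕ)  ≡⟨ cong (map suc) (tabulate-toℕ n) ⟩
      map suc (upTo n)        ≡⟨ map-upTo suc n ⟩
      applyUpTo suc n         ∎)

  module _ {P : Pred ℕ p} (P? : Decidable P) where

    count-allFin : ∀ n → count (P? ∘ toℕ) (allFin n) ≡ count P? (upTo n)
    count-allFin n = trans (sym (count-map P? toℕ (allFin n))) (cong (count P?) (map-toℕ-allFin n))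

    count-upTo-suc : ∀ l → count P? (upTo (suc l)) ≡ count P? [ 0 ] + count (P? ∘ suc) (upTo l)
    count-upTo-suc l = trans (count-++ P? [ 0 ] (applyUpTo suc l))
      (cong (_+_ (count P? [ 0 ])) (trans (cong (count P?) (sym (map-upTo suc l))) (count-map P? suc (upTo l))))

  count-upTo-+ : {P : Pred ℕ p} (P? : Decidable P) → ∀ k l →
                 count P? (upTo (k + l)) ≡ count P? (upTo k) + count (P? ∘ (_+_ k)) (upTo l)
  count-upTo-+ P? zero    l = refl
  count-upTo-+ P? (suc k) l = begin
    count P? (upTo (suc k + l))
      ≡⟨ count-upTo-suc P? (k + l) ⟩
    count P? [ 0 ] + count (P? ∘ suc) (upTo (k + l))
      ≡⟨ cong (_+_ (count P? [ 0 ])) (count-upTo-+ (P? ∘ suc) k l) ⟩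
    count P? [ 0 ] + (count (P? ∘ suc) (upTo k) + count (P? ∘ (_+_ (suc k))) (upTo l))
      ≡⟨ +-assoc (count P? [ 0 ]) _ _ ⟨
    count P? [ 0 ] + count (P? ∘ suc) (upTo k) + count (P? ∘ (_+_ (suc k))) (upTo l)
      ≡⟨ cong (_+ count (P? ∘ (_+_ (suc k))) (upTo l)) (count-upTo-suc P? k) ⟨
    count P? (upTo (suc k)) + count (P? ∘ (_+_ (suc k))) (upTo l)
      ∎
    where open ≡-Reasoning

  suc-invariant⇒constant : (f : ℤ → A) → (∀ u → f u ≡ f (u +ℤ 1ℤ)) → ∀ u → f u ≡ f 0ℤ
  suc-invariant⇒constant f inv (+ zero)     = refl
  suc-invariant⇒constant f inv (+ suc k)    =
    trans (cong (f ∘ +_) (+-comm 1 k)) (trans (sym (inv (+ k))) (suc-invariant⇒constant f inv (+ k)))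
  suc-invariant⇒constant f inv -[1+ zero ]  = inv -[1+ zero ]
  suc-invariant⇒constant f inv -[1+ suc k ] = trans (inv -[1+ suc k ]) (suc-invariant⇒constant f inv -[1+ k ])

  module _ (m : ℕ) where

    multiple? : (u : ℤ) → Decidable (λ t → + m ∣ + t +ℤ u)
    multiple? u t = + m ∣? + t +ℤ u

    multiples : ℤ → ℕ → ℕ
    multiples u l = count (multiple? u) (upTo l)

    count-multiple?-shift : ∀ k u xs → count (multiple? u ∘ (_+_ k)) xs ≡ count (multiple? (u +ℤ + k)) xs
    count-multiple?-shift k u = count-∘-cong (+ m ∣?_) λ t →
      trans (cong (_+ℤ u) (pos-+ k t)) (reorder (+ k) (+ t) u)
      where reorder : ∀ k t u → k +ℤ t +ℤ u ≡ t +ℤ (u +ℤ k)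
            reorder = solve-∀

    count-multiple?-periodic : ∀ u xs → count (multiple? (u +ℤ + m)) xs ≡ count (multiple? u) xs
    count-multiple?-periodic u = count-⇔ _ _ λ t → ∣-shift ∣-refl (reassoc (+ t) u (+ m))
      where reassoc : ∀ t u m → t +ℤ u +ℤ m ≡ t +ℤ (u +ℤ m)
            reassoc = solve-∀

    -- [0, m + 1) is both [0, m) ∪ {m} and {0} ∪ (1 + [0, m)), and m ∣ m + u iff m ∣ 0 + u.
    multiples-suc : ∀ u → multiples u m ≡ multiples (u +ℤ 1ℤ) m
    multiples-suc u = +-cancelʳ-≡ (multiples u 1) _ _ (begin
      multiples u m + multiples u 1
        ≡⟨ trans (count-upTo-+ (multiple? u) m 1) (cong (_+_ (multiples u m))
             (trans (count-multiple?-shift m u (upTo 1)) (count-multiple?-periodic u (upTo 1)))) ⟨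
      multiples u (m + 1)
        ≡⟨ cong (multiples u) (+-comm m 1) ⟩
      multiples u (1 + m)
        ≡⟨ count-upTo-+ (multiple? u) 1 m ⟩
      multiples u 1 + count (multiple? u ∘ (_+_ 1)) (upTo m)
        ≡⟨ cong (_+_ (multiples u 1)) (count-multiple?-shift 1 u (upTo m)) ⟩
      multiples u 1 + multiples (u +ℤ 1ℤ) m
        ≡⟨ +-comm _ (multiples (u +ℤ 1ℤ) m) ⟩
      multiples (u +ℤ 1ℤ) m + multiples u 1
        ∎)
      where open ≡-Reasoning

  multiples-zero : ∀ m → multiples (suc m) 0ℤ (suc m) ≡ 1
  multiples-zero m = begin
    multiples (suc m) 0ℤ (suc m)
      ≡⟨ count-upTo-suc (multiple? (suc m) 0ℤ) m ⟩
    count (multiple? (suc m) 0ℤ) [ 0 ] + count (multiple? (suc m) 0ℤ ∘ suc) (upTo m)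
      ≡⟨ cong₂ _+_ (cong length (filter-accept (multiple? (suc m) 0ℤ) {xs = []} (divides 0ℤ refl)))
                   (count-none (multiple? (suc m) 0ℤ ∘ suc) (applyUpTo⁺₁ (λ t → t) m no-multiple)) ⟩
    1
      ∎
    where
    open ≡-Reasoning
    no-multiple : ∀ {t} → t < m → ¬ (+ suc m ∣ + suc t +ℤ 0ℤ)
    no-multiple {t} t<m m∣ = <⇒≱ (s<s t<m) (subst (suc m ℕ.≤_) (+-identityʳ (suc t)) (∣⇒≤ (∣⇒∣ᵤ m∣)))

  multiples-period : ∀ m u → multiples (suc m) u (suc m) ≡ 1
  multiples-period m u =
    trans (suc-invariant⇒constant (λ u → multiples (suc m) u (suc m)) (multiples-suc (suc m)) u)
          (multiples-zero m)

  multiples-periods : ∀ m q u → multiples (suc m) u (suc m * q) ≡ q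
  multiples-periods m zero    u = cong (multiples (suc m) u) (*-zeroʳ m)
  multiples-periods m (suc q) u = begin
    multiples (suc m) u (suc m * suc q)
      ≡⟨ cong (multiples (suc m) u) (*-suc (suc m) q) ⟩
    multiples (suc m) u (suc m + suc m * q)
      ≡⟨ count-upTo-+ (multiple? (suc m) u) (suc m) (suc m * q) ⟩
    multiples (suc m) u (suc m) + count (multiple? (suc m) u ∘ (_+_ (suc m))) (upTo (suc m * q))
      ≡⟨ cong₂ _+_ (multiples-period m u)
                   (trans (count-multiple?-shift (suc m) (suc m) u (upTo (suc m * q)))
                          (multiples-periods m q (u +ℤ + suc m))) ⟩
    suc q
      ∎
    where open ≡-Reasoning

  count-multiples : ∀ {n} .{{_ : NonZero n}} m q u → m * q ≡ n →
                    count (λ a → + m ∣? + toℕ a +ℤ u) (allFin n) ≡ q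
  count-multiples {n} zero    q u 0≡n  = contradiction (sym 0≡n) (ℕ.≢-nonZero⁻¹ n)
  count-multiples     (suc m) q u refl =
    trans (count-allFin (multiple? (suc m) u) (suc m * q)) (multiples-periods m q u)

module ChineseRemainder {n : ℕ} (m₁ m₂ : ℕ) where

  open Counting
  open Divisibility using (∣-shift; ∣-+-cong; lcm∣⇔; bézout)
  open Residues using (count-multiples)
  open import Data.Nat.GCD using (gcd; gcd[m,n]∣m; gcd[m,n]∣n)
  open import Data.Nat.LCM using (lcm)
  open import Data.Integer using (ℤ; +_; -_; _+_; _-_; _*_)
  open import Data.Integer.Divisibility.Signed using (_∣_; _∣?_; divides; ∣ᵤ⇒∣; ∣-trans; ∣m∣n⇒∣m-n)
  open import Data.Integer.Tactic.RingSolver using (solve-∀)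
  open import Data.Fin using (Fin; toℕ)
  open import Data.List using (allFin)
  open import Data.List.Relation.Unary.All using (universal)
  open import Data.Product using (_×_; _,_)
  open import Function using (_∘_; _⇔_; mk⇔; Equivalence)
  open Equivalence using (to; from)
  open import Relation.Nullary using (¬_; yes; no)
  open import Relation.Nullary.Decidable using (_×-dec_)
  open import Relation.Unary using (Decidable)
  open import Relation.Binary.PropositionalEquality using (sym; trans; cong; subst; module ≡-Reasoning)

  private
    g = gcd m₁ m₂
    L = lcm m₁ m₂

  simultaneous? : (z u : ℤ) → Decidable (λ (a : Fin n) → + m₁ ∣ + toℕ a - z × + m₂ ∣ + toℕ a + u)
  simultaneous? z u a = (+ m₁ ∣? + toℕ a - z) ×-dec (+ m₂ ∣? + toℕ a + u)

  solutions : ℤ → ℤ → ℕ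
  solutions z u = count (simultaneous? z u) (allFin n)

  simultaneous⇔lcm∣ : ∀ z u w t → + m₁ ∣ w - z → + m₂ ∣ w + u →
                      (+ m₁ ∣ t - z × + m₂ ∣ t + u) ⇔ + L ∣ t - w
  simultaneous⇔lcm∣ z u w t m₁∣w-z m₂∣w+u = mk⇔
    (λ (m₁∣ , m₂∣) → from (lcm∣⇔ m₁ m₂ (t - w)) (to via₁ m₁∣ , to via₂ m₂∣))
    (λ L∣ → let (m₁∣ , m₂∣) = to (lcm∣⇔ m₁ m₂ (t - w)) L∣ in from via₁ m₁∣ , from via₂ m₂∣)
    where
    split : ∀ t w v → (t - w) + (w + v) ≡ t + v
    split = solve-∀
    via₁ : + m₁ ∣ t - z ⇔ + m₁ ∣ t - w
    via₁ = ∣-shift m₁∣w-z (split t w (- z))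
    via₂ : + m₂ ∣ t + u ⇔ + m₂ ∣ t - w
    via₂ = ∣-shift m₂∣w+u (split t w u)

  simultaneous⇒gcd∣ : ∀ z u t → + m₁ ∣ t - z → + m₂ ∣ t + u → + g ∣ z + u
  simultaneous⇒gcd∣ z u t m₁∣ m₂∣ =
    subst (+ g ∣_) (difference t z u)
      (∣m∣n⇒∣m-n (∣-trans (∣ᵤ⇒∣ (gcd[m,n]∣n m₁ m₂)) m₂∣) (∣-trans (∣ᵤ⇒∣ (gcd[m,n]∣m m₁ m₂)) m₁∣))
    where difference : ∀ t z u → (t + u) - (t - z) ≡ z + u
          difference = solve-∀

  module _ .{{_ : NonZero n}} {q} (Lq≡n : L ℕ.* q ≡ n) where

    -- With g = X m₁ + Y m₂ and z + u = e g, the residue w = z − e X m₁ solves both congruences.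
    solutions-solvable : ∀ z u → + g ∣ z + u → solutions z u ≡ q
    solutions-solvable z u (divides e z+u≡eg) with bézout m₁ m₂
    ... | X , Y , g≡Xm₁+Ym₂ =
      trans (count-⇔ (simultaneous? z u) (λ a → + L ∣? + toℕ a - w)
                     (λ a → simultaneous⇔lcm∣ z u w (+ toℕ a) m₁∣w-z m₂∣w+u) (allFin n))
            (count-multiples L q (- w) Lq≡n)
      where
      w = z + - (e * X) * + m₁
      m₁∣w-z : + m₁ ∣ w - z
      m₁∣w-z = divides (- (e * X)) (cancel z (e * X) (+ m₁))
        where cancel : ∀ z c m → (z + - c * m) - z ≡ - c * m
              cancel = solve-∀
      m₂∣w+u : + m₂ ∣ w + u
      m₂∣w+u = divides (e * Y) (begin
        w + u                                    ≡⟨ regroup z u (e * X) (+ m₁) ⟩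
        (z + u) - e * X * + m₁                   ≡⟨ cong (λ v → v - e * X * + m₁) z+u≡eg ⟩
        e * + g - e * X * + m₁                   ≡⟨ cong (λ v → e * v - e * X * + m₁) g≡Xm₁+Ym₂ ⟩
        e * (X * + m₁ + Y * + m₂) - e * X * + m₁ ≡⟨ expand e X Y (+ m₁) (+ m₂) ⟩
        e * Y * + m₂                             ∎)
        where
        open ≡-Reasoning
        regroup : ∀ z u c m → (z + - c * m) + u ≡ (z + u) - c * m
        regroup = solve-∀
        expand : ∀ e X Y m₁ m₂ → e * (X * m₁ + Y * m₂) - e * X * m₁ ≡ e * Y * m₂
        expand = solve-∀

    solutions-unsolvable : ∀ z u → ¬ (+ g ∣ z + u) → solutions z u ≡ 0
    solutions-unsolvable z u g∤ = count-none (simultaneous? z u)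
      (universal (λ a (m₁∣ , m₂∣) → g∤ (simultaneous⇒gcd∣ z u (+ toℕ a) m₁∣ m₂∣)) (allFin n))

    solutions-cong : ∀ z u u′ → + g ∣ u - u′ → solutions z u ≡ solutions z u′
    solutions-cong z u u′ g∣u-u′ with + g ∣? z + u
    ... | yes g∣z+u = trans (solutions-solvable z u g∣z+u)
                            (sym (solutions-solvable z u′ (to (∣-+-cong z g∣u-u′) g∣z+u)))
    ... | no  g∤z+u = trans (solutions-unsolvable z u g∤z+u)
                            (sym (solutions-unsolvable z u′ (g∤z+u ∘ from (∣-+-cong z g∣u-u′))))

module Vectors where

  open Counting
  open import Data.Nat using (zero; suc)
  open import Data.Nat.ListAction using (sum)
  open import Data.Integer using (_+_)
  open import Data.Fin using (Fin)
  open import Data.List using (map; allFin)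
  open import Data.List.Properties using (map-cong)
  open import Data.Vec.Functional using (Vector; _∷_)
  open import Function using (_∘_; mk⇔)
  open import Level using (Level)
  open import Relation.Unary using (Pred; Decidable)
  open import Relation.Binary.PropositionalEquality using (_≗_; refl; sym; trans; cong; cong₂)

  private variable
    p : Level
    n k : ℕ

  sumℤ-cong : {x y : Vector (Fin n) k} → x ≗ y → sumℤ x ≡ sumℤ y
  sumℤ-cong {k = zero}  x≗y = refl
  sumℤ-cong {k = suc k} x≗y = cong₂ _+_ (cong ι (x≗y Fin.zero)) (sumℤ-cong (x≗y ∘ Fin.suc))

  -- allVecs extends vectors by a pattern-matching lambda that agrees with _∷_ only pointwise,
  -- hence the hypothesis that P respects ≗.
  count-allVecs-suc : {P : Pred (Vector (Fin n) (suc k)) p} (P? : Decidable P) →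
                      (∀ {x y} → x ≗ y → P x → P y) →
                      count P? (allVecs (suc k) n)
                        ≡ sum (map (λ a → count (P? ∘ (a ∷_)) (allVecs k n)) (allFin n))
  count-allVecs-suc {n = n} {k = k} P? resp =
    trans (count-concatMap P? _ (allFin n))
          (cong sum (map-cong (count-map-cons _ λ a v → λ { Fin.zero → refl ; (Fin.suc i) → refl }) (allFin n)))
    where
    count-map-cons : (cons : Fin n → Vector (Fin n) k → Vector (Fin n) (suc k)) → (∀ a v → cons a v ≗ a ∷ v) →
                     ∀ a → count P? (map (cons a) (allVecs k n)) ≡ count (P? ∘ (a ∷_)) (allVecs k n)
    count-map-cons cons cons≗∷ a = trans (count-map P? (cons a) (allVecs k n))
      (count-⇔ _ _ (λ v → mk⇔ (resp (cons≗∷ a v)) (resp (sym ∘ cons≗∷ a v))) (allVecs k n))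

module Fibres {n : ℕ} (m₁ m₂ : ℕ) where

  open Counting
  open Vectors
  open ChineseRemainder {n} m₁ m₂ using (solutions)
  open import Data.Nat using (suc; _*_)
  open import Data.Nat.ListAction using (sum)
  open import Data.Integer using (ℤ; +_; _+_; _-_; 0ℤ)
  open import Data.Integer.Properties using (+-identityˡ; +-identityʳ; +-inverseʳ)
  open import Data.Integer.Divisibility.Signed using (_∣_; _∣?_; divides)
  open import Data.Integer.Tactic.RingSolver using (solve-∀)
  open import Data.Fin using (Fin)
  open import Data.List using (map; allFin)
  open import Data.List.Properties using (map-cong)
  open import Data.List.Relation.Unary.All using (universal)
  open import Data.Vec.Functional using (Vector; _∷_)
  open import Data.Product using (_×_; _,_; proj₁; proj₂)
  open import Function using (_∘_; _⇔_; mk⇔; Equivalence)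
  open Equivalence using (to; from)
  open import Relation.Nullary using (¬_)
  open import Relation.Nullary.Decidable using (_×-dec_)
  open import Relation.Unary using (Pred; Decidable)
  open import Relation.Binary.PropositionalEquality using (_≗_; sym; trans; cong; subst)

  private variable
    k : ℕ

  Fibre : ℤ → ℤ → Pred (Vector (Fin n) k) _
  Fibre z s x = (∀ i → + m₁ ∣ ι (x i) - z) × + m₂ ∣ sumℤ x + s

  fibre? : ∀ z s → Decidable (Fibre {k} z s)
  fibre? {k} z s x = allFin? k (λ i → + m₁ ∣? ι (x i) - z) ×-dec (+ m₂ ∣? sumℤ x + s)

  fibres : ℕ → ℤ → ℤ → ℕ
  fibres k z s = count (fibre? z s) (allVecs k n)

  Fibre-resp-≗ : ∀ z s {x y : Vector (Fin n) k} → x ≗ y → Fibre z s x → Fibre z s y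
  Fibre-resp-≗ z s x≗y (x≡z , m₂∣) =
    (λ i → subst (λ a → + m₁ ∣ ι a - z) (x≗y i) (x≡z i)) , subst (λ t → + m₂ ∣ t + s) (sumℤ-cong x≗y) m₂∣

  Fibre-∷ : ∀ z s a (v : Vector (Fin n) k) → Fibre z s (a ∷ v) ⇔ (+ m₁ ∣ ι a - z × Fibre z (ι a + s) v)
  Fibre-∷ z s a v = mk⇔
    (λ (x≡z , m₂∣) → x≡z Fin.zero , x≡z ∘ Fin.suc , subst (+ m₂ ∣_) (reassoc (ι a) (sumℤ v) s) m₂∣)
    (λ (a≡z , v≡z , m₂∣) → (λ { Fin.zero → a≡z ; (Fin.suc i) → v≡z i }) ,
                          subst (+ m₂ ∣_) (sym (reassoc (ι a) (sumℤ v) s)) m₂∣)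
    where reassoc : ∀ a v s → a + v + s ≡ v + (a + s)
          reassoc = solve-∀

  Fibre-[] : ∀ z s (e : Vector (Fin n) 0) → Fibre z s e ⇔ + m₂ ∣ s
  Fibre-[] z s e = mk⇔ (subst (+ m₂ ∣_) (+-identityˡ s) ∘ proj₂)
                       (λ m₂∣ → (λ ()) , subst (+ m₂ ∣_) (sym (+-identityˡ s)) m₂∣)

  fibres-one : ∀ z s → fibres 1 z s ≡ solutions z s
  fibres-one z s = trans (count-allVecs-suc (fibre? z s) (Fibre-resp-≗ z s))
    (trans (sum-count-singleton (λ a → fibre? z s ∘ (a ∷_)) _ (allFin n)) (count-⇔ _ _ (single _) (allFin n)))
    where
    single : ∀ e a → Fibre z s (a ∷ e) ⇔ (+ m₁ ∣ ι a - z × + m₂ ∣ ι a + s)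
    single e a = mk⇔
      (λ F → let (a≡z , F′) = to (Fibre-∷ z s a e) F in a≡z , to (Fibre-[] z (ι a + s) e) F′)
      (λ (a≡z , m₂∣) → from (Fibre-∷ z s a e) (a≡z , from (Fibre-[] z (ι a + s) e) m₂∣))

  fibres-suc : ∀ k z s C → (∀ a → + m₁ ∣ ι a - z → fibres k z (ι a + s) ≡ C) →
               fibres (suc k) z s ≡ count (λ a → + m₁ ∣? ι a - z) (allFin n) * C
  fibres-suc k z s C fibres≡C = trans (count-allVecs-suc (fibre? z s) (Fibre-resp-≗ z s))
    (sum-indicator (λ a → + m₁ ∣? ι a - z) _ C on-residue off-residue (allFin n))
    where
    on-residue : ∀ a → + m₁ ∣ ι a - z → count (fibre? z s ∘ (a ∷_)) (allVecs k n) ≡ C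
    on-residue a a≡z = trans
      (count-⇔ _ _ (λ v → mk⇔ (proj₂ ∘ to (Fibre-∷ z s a v)) (from (Fibre-∷ z s a v) ∘ (a≡z ,_))) (allVecs k n))
      (fibres≡C a a≡z)
    off-residue : ∀ a → ¬ (+ m₁ ∣ ι a - z) → count (fibre? z s ∘ (a ∷_)) (allVecs k n) ≡ 0
    off-residue a a≢z = count-none (fibre? z s ∘ (a ∷_))
      (universal (λ v → a≢z ∘ proj₁ ∘ to (Fibre-∷ z s a v)) (allVecs k n))

  anchored? : Decidable (λ (x : Vector (Fin n) (suc k)) → Fibre (ι (x Fin.zero)) 0ℤ x)
  anchored? x = fibre? (ι (x Fin.zero)) 0ℤ x

  count-anchored : ∀ k → count (anchored? {k}) (allVecs (suc k) n)
                         ≡ sum (map (λ a → fibres k (ι a) (ι a)) (allFin n))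
  count-anchored k = trans (count-allVecs-suc anchored? resp)
    (cong sum (map-cong (λ a → count-⇔ _ _ (head a) (allVecs k n)) (allFin n)))
    where
    resp : ∀ {x y : Vector (Fin n) (suc k)} → x ≗ y → Fibre (ι (x Fin.zero)) 0ℤ x → Fibre (ι (y Fin.zero)) 0ℤ y
    resp {x} {y} x≗y = subst (λ a → Fibre (ι a) 0ℤ y) (x≗y Fin.zero) ∘ Fibre-resp-≗ (ι (x Fin.zero)) 0ℤ x≗y
    head : ∀ a v → Fibre (ι a) 0ℤ (a ∷ v) ⇔ Fibre (ι a) (ι a) v
    head a v = mk⇔
      (subst (λ s → Fibre (ι a) s v) (+-identityʳ (ι a)) ∘ proj₂ ∘ to (Fibre-∷ (ι a) 0ℤ a v))
      (λ F → from (Fibre-∷ (ι a) 0ℤ a v)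
                 (divides 0ℤ (+-inverseʳ (ι a)) , subst (λ s → Fibre (ι a) s v) (sym (+-identityʳ (ι a))) F))

module SolutionCount (n m₁ m₂ d₁ d₂ : ℕ) .{{_ : NonZero n}}
                     (m₁d₁≡n : m₁ ℕ.* d₁ ≡ n) (m₂d₂≡n : m₂ ℕ.* d₂ ≡ n) where

  open Counting
  open Divisibility using (∣*⇔/gcd∣ℤ)
  open Residues using (count-multiples)
  open ChineseRemainder {n} m₁ m₂
  open Fibres {n} m₁ m₂
  open import Data.Nat using (zero; suc; _*_; _^_; _/_)
  open import Data.Nat.Properties using (*-comm; *-assoc; *-zeroʳ; *-identityʳ; *-cancelˡ-≡; m*n≢0)
    renaming (+-identityʳ to +-identityʳℕ)
  open import Data.Nat.Divisibility using (divides; quotient) renaming (∣-trans to ∣-transℕ)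
  open Data.Nat.Divisibility._∣_ using (equality)
  open import Data.Nat.DivMod using (m/n*n≡m)
  open import Data.Nat.GCD using (gcd; gcd[m,n]∣m; gcd[m,n]∣n; gcd[m,n]≢0; gcd-comm; gcd-zeroʳ)
  open import Data.Nat.LCM using (lcm; lcm-least; gcd*lcm)
  open import Data.Nat.ListAction using (sum)
  import Data.Nat.Tactic.RingSolver as ℕ-Solver
  open import Data.Integer using (+_; -_; _+_; _-_; 0ℤ) renaming (_*_ to _*ℤ_)
  open import Data.Integer.Properties using (+-identityʳ; pos-+)
  open import Data.Integer.Divisibility.Signed using (_∣_; _∣?_; ∣ᵤ⇒∣; ∣-trans)
  open import Data.Integer.Tactic.RingSolver using (solve-∀)
  open import Data.List using (map; allFin)
  open import Data.List.Properties using (map-cong)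
  open import Data.Sum using (inj₁)
  open import Function using (_∘_; _⇔_)
  open import Relation.Nullary using (¬_; contradiction)
  open import Relation.Binary.PropositionalEquality using (sym; trans; cong; cong₂; subst; module ≡-Reasoning)

  private
    nonZero-factor : ∀ a b → a * b ≡ n → NonZero a
    nonZero-factor zero    b 0≡n = contradiction (sym 0≡n) (ℕ.≢-nonZero⁻¹ n)
    nonZero-factor (suc a) b _   = _

    instance
      _ = nonZero-factor m₁ d₁ m₁d₁≡n
      _ = nonZero-factor m₂ d₂ m₂d₂≡n

    g = gcd m₁ m₂
    L = lcm m₁ m₂
    m₁∣n = divides d₁ (trans (sym m₁d₁≡n) (*-comm m₁ d₁))
    m₂∣n = divides d₂ (trans (sym m₂d₂≡n) (*-comm m₂ d₂))
    L∣n  = lcm-least m₁∣n m₂∣n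
    g∣n  = ∣-transℕ (gcd[m,n]∣m m₁ m₂) m₁∣n
    q    = quotient L∣n
    e    = quotient g∣n

    Lq≡n : L * q ≡ n
    Lq≡n = trans (*-comm L q) (sym (equality L∣n))

  fibres-closed : ∀ k z s → fibres (suc k) z s ≡ d₁ ^ k * solutions z (s + + k *ℤ z)
  fibres-closed zero    z s =
    trans (fibres-one z s) (sym (trans (+-identityʳℕ _) (cong (solutions z) (drop s z))))
    where drop : ∀ s z → s + + 0 *ℤ z ≡ s
          drop = solve-∀
  fibres-closed (suc k) z s = begin
    fibres (suc (suc k)) z s
      ≡⟨ fibres-suc (suc k) z s C fibres≡C ⟩
    count (λ a → + m₁ ∣? ι a - z) (allFin n) * C
      ≡⟨ cong (_* C) (count-multiples m₁ d₁ (- z) m₁d₁≡n) ⟩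
    d₁ * C
      ≡⟨ *-assoc d₁ (d₁ ^ k) _ ⟨
    d₁ ^ suc k * solutions z (s + + suc k *ℤ z)
      ∎
    where
    open ≡-Reasoning
    C = d₁ ^ k * solutions z (s + + suc k *ℤ z)
    difference : ∀ a s k z → (a + s + k *ℤ z) - (s + (+ 1 + k) *ℤ z) ≡ a - z
    difference = solve-∀
    fibres≡C : ∀ a → + m₁ ∣ ι a - z → fibres (suc k) z (ι a + s) ≡ C
    fibres≡C a m₁∣a-z = trans (fibres-closed k z (ι a + s)) (cong (d₁ ^ k *_)
      (solutions-cong Lq≡n z (ι a + s + + k *ℤ z) (s + + suc k *ℤ z)
        (subst (+ g ∣_) (sym (difference (ι a) s (+ k) z)) (∣-trans (∣ᵤ⇒∣ (gcd[m,n]∣m m₁ m₂)) m₁∣a-z))))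

  private
    e*q≡d₁*d₂ : e * q ≡ d₁ * d₂
    e*q≡d₁*d₂ = *-cancelˡ-≡ (e * q) (d₁ * d₂) (m₁ * m₂) {{m*n≢0 m₁ m₂}} (begin
      m₁ * m₂ * (e * q)      ≡⟨ cong (_* (e * q)) (gcd*lcm m₁ m₂) ⟨
      g * L * (e * q)        ≡⟨ interchange g L e q ⟩
      e * g * (L * q)        ≡⟨ cong₂ _*_ (sym (equality g∣n)) Lq≡n ⟩
      n * n                  ≡⟨ cong₂ _*_ m₁d₁≡n m₂d₂≡n ⟨
      m₁ * d₁ * (m₂ * d₂)    ≡⟨ interchange′ m₁ d₁ m₂ d₂ ⟩
      m₁ * m₂ * (d₁ * d₂)    ∎)
      where
      open ≡-Reasoning
      interchange : ∀ g L e q → g * L * (e * q) ≡ e * g * (L * q)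
      interchange = ℕ-Solver.solve-∀
      interchange′ : ∀ m₁ d₁ m₂ d₂ → m₁ * d₁ * (m₂ * d₂) ≡ m₁ * m₂ * (d₁ * d₂)
      interchange′ = ℕ-Solver.solve-∀

  count-gcd∣* : ∀ R .{{_ : NonZero R}} → count (λ a → + g ∣? + R *ℤ ι a) (allFin n) ≡ e * gcd R g
  count-gcd∣* R = trans
    (count-⇔ _ _ (λ a → subst (λ t → + g ∣ + R *ℤ ι a ⇔ + (g / h) ∣ t) (sym (+-identityʳ (ι a)))
                                (∣*⇔/gcd∣ℤ g (+ R) (ι a)))
             (allFin n))
    (count-multiples (g / h) (e * h) 0ℤ (begin
      g / h * (e * h)   ≡⟨ rearrange (g / h) e h ⟩
      g / h * h * e     ≡⟨ cong (_* e) (m/n*n≡m (gcd[m,n]∣n R g)) ⟩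
      g * e             ≡⟨ *-comm g e ⟩
      e * g             ≡⟨ equality g∣n ⟨
      n                 ∎))
    where
    open ≡-Reasoning
    h = gcd R g
    instance _ = ℕ.≢-nonZero (gcd[m,n]≢0 R g (inj₁ (ℕ.≢-nonZero⁻¹ R)))
    rearrange : ∀ a e h → a * (e * h) ≡ a * h * e
    rearrange = ℕ-Solver.solve-∀

  sum-diagonal-fibres : ∀ k → sum (map (λ a → fibres (suc k) (ι a) (ι a)) (allFin n))
                            ≡ count (λ a → + g ∣? + (2 ℕ.+ k) *ℤ ι a) (allFin n) * (d₁ ^ k * q)
  sum-diagonal-fibres k =
    trans (cong sum (map-cong (λ a → fibres-closed k (ι a) (ι a)) (allFin n)))
          (sum-indicator (λ a → + g ∣? + (2 ℕ.+ k) *ℤ ι a) _ (d₁ ^ k * q) solvable unsolvable (allFin n))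
    where
    shift≡r*a : ∀ a → ι a + (ι a + + k *ℤ ι a) ≡ + (2 ℕ.+ k) *ℤ ι a
    shift≡r*a a = trans (collect (ι a) (+ k)) (cong (_*ℤ ι a) (sym (pos-+ 2 k)))
      where collect : ∀ a k → a + (a + k *ℤ a) ≡ (+ 2 + k) *ℤ a
            collect = solve-∀
    solvable : ∀ a → + g ∣ + (2 ℕ.+ k) *ℤ ι a → d₁ ^ k * solutions (ι a) (ι a + + k *ℤ ι a) ≡ d₁ ^ k * q
    solvable a g∣ = cong (d₁ ^ k *_)
      (solutions-solvable Lq≡n (ι a) (ι a + + k *ℤ ι a) (subst (+ g ∣_) (sym (shift≡r*a a)) g∣))
    unsolvable : ∀ a → ¬ (+ g ∣ + (2 ℕ.+ k) *ℤ ι a) → d₁ ^ k * solutions (ι a) (ι a + + k *ℤ ι a) ≡ 0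
    unsolvable a g∤ = trans (cong (d₁ ^ k *_)
      (solutions-unsolvable Lq≡n (ι a) (ι a + + k *ℤ ι a) (g∤ ∘ subst (+ g ∣_) (shift≡r*a a))))
      (*-zeroʳ (d₁ ^ k))

  count-anchored-closed : ∀ k → count (anchored? {k}) (allVecs (suc k) n) ≡ d₁ ^ k * d₂ * gcd g (suc k)
  count-anchored-closed zero = begin
    count anchored? (allVecs 1 n)                       ≡⟨ count-anchored 0 ⟩
    sum (map (λ a → fibres 0 (ι a) (ι a)) (allFin n))
      ≡⟨ sum-count-singleton (λ a → fibre? (ι a) (ι a)) _ (allFin n) ⟩
    count (λ a → fibre? (ι a) (ι a) _) (allFin n)       ≡⟨ count-⇔ _ _ (λ a → empty-fibre a _) (allFin n) ⟩
    count (λ a → + m₂ ∣? ι a + 0ℤ) (allFin n)           ≡⟨ count-multiples m₂ d₂ 0ℤ m₂d₂≡n ⟩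
    d₂                                                  ≡⟨ trans (cong₂ _*_ (+-identityʳℕ d₂) (gcd-zeroʳ g))
                                                                 (*-identityʳ d₂) ⟨
    1 * d₂ * gcd g 1                                    ∎
    where
    open ≡-Reasoning
    empty-fibre : ∀ a e → Fibre (ι a) (ι a) e ⇔ + m₂ ∣ ι a + 0ℤ
    empty-fibre a e =
      subst (λ t → Fibre (ι a) (ι a) e ⇔ + m₂ ∣ t) (sym (+-identityʳ (ι a))) (Fibre-[] (ι a) (ι a) e)
  count-anchored-closed (suc k) = begin
    count anchored? (allVecs (suc (suc k)) n)                  ≡⟨ count-anchored (suc k) ⟩
    sum (map (λ a → fibres (suc k) (ι a) (ι a)) (allFin n))    ≡⟨ sum-diagonal-fibres k ⟩
    count (λ a → + g ∣? + r *ℤ ι a) (allFin n) * (d₁ ^ k * q)  ≡⟨ cong (_* (d₁ ^ k * q)) (count-gcd∣* r) ⟩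
    e * gcd r g * (d₁ ^ k * q)                                 ≡⟨ rearrange e (gcd r g) (d₁ ^ k) q ⟩
    e * q * (d₁ ^ k * gcd r g)                                 ≡⟨ cong (_* (d₁ ^ k * gcd r g)) e*q≡d₁*d₂ ⟩
    d₁ * d₂ * (d₁ ^ k * gcd r g)                               ≡⟨ rearrange′ d₁ d₂ (d₁ ^ k) (gcd r g) ⟩
    d₁ ^ suc k * d₂ * gcd r g                                  ≡⟨ cong (d₁ ^ suc k * d₂ *_) (gcd-comm r g) ⟩
    d₁ ^ suc k * d₂ * gcd g r                                  ∎
    where
    open ≡-Reasoning
    r = 2 ℕ.+ k
    rearrange : ∀ e h x q → e * h * (x * q) ≡ e * q * (x * h)
    rearrange = ℕ-Solver.solve-∀
    rearrange′ : ∀ a b x h → a * b * (x * h) ≡ a * x * b * h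
    rearrange′ = ℕ-Solver.solve-∀

module Anchoring where

  open Divisibility using (≡0mod⇔)
  open import Data.Nat using (suc)
  open import Data.Integer using (ℤ; +_; _+_; _-_; _*_; 0ℤ)
  open import Data.Integer.Properties using (+-identityʳ; +-inverseʳ)
  open import Data.Integer.Divisibility.Signed using (_∣_; divides; ∣m∣n⇒∣m-n)
  open import Data.Integer.Tactic.RingSolver using (solve-∀)
  open import Data.Fin using (Fin; zero; fromℕ; inject₁)
  open import Data.Fin.Induction using (>-weakInduction)
  open import Data.Vec.Functional using (Vector)
  open import Data.Product using (_,_)
  open import Function using (_∘_; _⇔_; mk⇔; Equivalence)
  open Equivalence using (to; from)
  open import Relation.Binary.PropositionalEquality using (sym; subst)

  congruent⇒pairwise : ∀ {k} m (f : Fin k → ℤ) z → (∀ i → + m ∣ f i - z) → ∀ i j → + m ∣ f i - f j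
  congruent⇒pairwise m f z f≡z i j = subst (+ m ∣_) (cancel (f i) (f j) z) (∣m∣n⇒∣m-n (f≡z i) (f≡z j))
    where cancel : ∀ a b z → (a - z) - (b - z) ≡ a - b
          cancel = solve-∀

  congruent-to-last⇔first : ∀ {n k} m (x : Vector (Fin n) (suc k)) →
                            (∀ i → + m ∣ ι (x (inject₁ i)) - ι (x (fromℕ k)))
                            ⇔ (∀ i → + m ∣ ι (x i) - ι (x zero))
  congruent-to-last⇔first {k = k} m x = mk⇔
    (λ x≡last i → congruent⇒pairwise m (ι ∘ x) (ι (x (fromℕ k)))
                    (>-weakInduction (λ i → + m ∣ ι (x i) - ι (x (fromℕ k)))
                                     (divides 0ℤ (+-inverseʳ (ι (x (fromℕ k))))) (λ i _ → x≡last i))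
                    i zero)
    (λ x≡first i → congruent⇒pairwise m (ι ∘ x) (ι (x zero)) x≡first (inject₁ i) (fromℕ k))

  IsSolution⇔anchored : ∀ c d r′ n .{{_ : NonZero n}} (x : Vector (Fin n) (suc r′)) →
                        IsSolution c d r′ n x ⇔
                        Fibres.Fibre (n/gcdℤ (c - d) n) (n/gcdℤ (c + + r′ * d) n) (ι (x zero)) 0ℤ x
  IsSolution⇔anchored c d r′ n x = mk⇔
    (λ (differences , sum) →
       to (congruent-to-last⇔first m₁ x) (λ i → to (≡0mod⇔ n (c - d) _) (differences i)) ,
       subst (+ m₂ ∣_) (sym (+-identityʳ (sumℤ x))) (to (≡0mod⇔ n (c + + r′ * d) (sumℤ x)) sum))
    (λ (x≡first , m₂∣) →
       (λ i → from (≡0mod⇔ n (c - d) _) (from (congruent-to-last⇔first m₁ x) x≡first i)) ,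
       from (≡0mod⇔ n (c + + r′ * d) (sumℤ x)) (subst (+ m₂ ∣_) (+-identityʳ (sumℤ x)) m₂∣))
    where
    m₁ = n/gcdℤ (c - d) n
    m₂ = n/gcdℤ (c + + r′ * d) n

open Counting using (count-⇔)
open Anchoring using (IsSolution⇔anchored)
open import Data.Nat using (suc; _*_; _^_)
open import Data.Nat.GCD using (gcd; gcd[m,n]∣n)
open import Data.Nat.DivMod using (m/n*n≡m)
open import Data.Integer using (ℤ; +_; _-_)

theorem5p3 : (r' n : ℕ) → .{{_ : NonZero n}} → (c d : ℤ) →
    Scoroot c d r' n
    ≡ (gcdℤ (c - d) n ^ r') * gcdℤ (c Data.Integer.+ (+ r') Data.Integer.* d) n
    * gcd (gcd (n/gcdℤ (c - d) n) (n/gcdℤ (c Data.Integer.+ (+ r') Data.Integer.* d) n)) (suc r')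
theorem5p3 r' n c d =
  trans (count-⇔ (isSolution? c d r' n) (Fibres.anchored? m₁ m₂) (IsSolution⇔anchored c d r' n)
                 (allVecs (suc r') n))
        (SolutionCount.count-anchored-closed n m₁ m₂ (gcdℤ a₁ n) (gcdℤ a₂ n) (m*d≡n a₁) (m*d≡n a₂) r')
  where
  a₁ = c - d
  a₂ = c Data.Integer.+ (+ r') Data.Integer.* d
  m₁ = n/gcdℤ a₁ n
  m₂ = n/gcdℤ a₂ n
  m*d≡n : ∀ a → n/gcdℤ a n * gcdℤ a n ≡ n
  m*d≡n a = m/n*n≡m {{gcdℤ-nonZero a n}} (gcd[m,n]∣n (Data.Integer.∣ a ∣) n)
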